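{- The Armanios-Wells graph is a Cayley graph over the group $(\mathbb{Z}_2\times Q_8)\rtimes\mathbb{Z}_2$; more precisely, over the group $G$ generated by four elements $g_1,g_2,g_3,g_4$, each of order $2$, such that the commutators $[g_i,g_j]$ for $i\ne j$ are all equal to one and the same element.
   Context: The Armanios-Wells graph is the unique distance-regular graph with intersection array $\{5,4,1,1;1,1,4,5\}$ (on $32$ vertices). A connected graph is distance-regular with intersection array $\{b_0,\dots,b_{d-1};c_1,\dots,c_d\}$ if for all vertices $x,y$ at distance $i$, $y$ has exactly $c_i$ neighbours at distance $i-1$ from $x$ and exactly $b_i$ neighbours at distance $i+1$ from $x$. $Q_8$ denotes the quaternion group of order $8$; the group $G$ described (of order $32$) is isomorphic to $(\mathbb{Z}_2\times Q_8)\rtimes\mathbb{Z}_2$. A graph is a Cayley graph over $G$ if it is isomorphic to $\mathrm{Cay}(G,S)$ for some inverse-closed $S\subseteq G\setminus\{e\}$, where $a\sim b$ iff $ab^{ -1}\in S$. -}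

module Defs where

open import Data.Bool using (Bool; true; false; _xor_; _∧_)
open import Data.Nat using (ℕ; zero; suc; _≤_)
open import Data.Fin using (Fin; toℕ)
open import Data.Vec using (Vec; lookup)
open import Data.List using (List; []; _∷_; length; foldr)
open import Data.List.Membership.Propositional using (_∈_)
open import Data.List.Relation.Unary.Unique.Propositional using (Unique)
open import Data.Product using (Σ; _×_; ∃-syntax)
open import Function.Bundles using (_⇔_)
open import Relation.Binary.PropositionalEquality using (_≡_; _≢_)
open import Relation.Nullary using (¬_)

-- G is the group generated by g₁,g₂,g₃,g₄, each of order 2, with all
-- commutators [gᵢ,gⱼ] (i ≠ j) equal to one common element c.
-- From the relations, c is central of order 2 and G/⟨c⟩ ≅ ℤ₂⁴, so G is
-- a central extension of ℤ₂⁴ by ⟨c⟩ ≅ ℤ₂.  Concretely an element is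
-- c^z · g₁^x₁ g₂^x₂ g₃^x₃ g₄^x₄, stored as (x₁,x₂,x₃,x₄,z) ∈ ℤ₂⁵ (ℤ₂ = Bool,
-- addition = xor), with multiplication given by the 2-cocycle β below:
--   (v , a) · (w , b) = (v + w , a + b + β(v,w)),
--   β(v,w) = Σ_{i>j} vᵢ wⱼ.

record G : Set where
  constructor mkG
  field
    x₁ x₂ x₃ x₄ z : Bool

β : G → G → Bool
β (mkG v₁ v₂ v₃ v₄ _) (mkG w₁ w₂ w₃ w₄ _) =
  (v₂ ∧ w₁) xor (v₃ ∧ w₁) xor (v₃ ∧ w₂) xor (v₄ ∧ w₁) xor (v₄ ∧ w₂) xor (v₄ ∧ w₃)

infixl 7 _·_
_·_ : G → G → G
p@(mkG v₁ v₂ v₃ v₄ a) · q@(mkG w₁ w₂ w₃ w₄ b) =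
  mkG (v₁ xor w₁) (v₂ xor w₂) (v₃ xor w₃) (v₄ xor w₄) (a xor b xor β p q)

e : G
e = mkG false false false false false

inv : G → G
inv p@(mkG v₁ v₂ v₃ v₄ a) = mkG v₁ v₂ v₃ v₄ (a xor β p p)

gen : Fin 4 → G
gen Fin.zero = mkG true false false false false
gen (Fin.suc Fin.zero) = mkG false true false false false
gen (Fin.suc (Fin.suc Fin.zero)) = mkG false false true false false
gen (Fin.suc (Fin.suc (Fin.suc Fin.zero))) = mkG false false false true false

comm : G → G → G
comm x y = x · y · inv x · inv y

word : List (Fin 4) → G
word = foldr (λ i g → gen i · g) e

Cay : (G → Bool) → G → G → Set
Cay S a b = S (a · inv b) ≡ true

module _ {V : Set} (Adj : V → V → Set) where

  data Walk : ℕ → V → V → Set where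
    here : ∀ {x} → Walk zero x x
    step : ∀ {n x y z} → Adj x y → Walk n y z → Walk (suc n) x z

  Dist : ℕ → V → V → Set
  Dist n x y = Walk n x y × (∀ m → Walk m x y → n ≤ m)

  HasExactly : ℕ → (V → Set) → Set
  HasExactly k P = Σ (List V) λ l → length l ≡ k × Unique l × (∀ z → (z ∈ l) ⇔ P z)

  -- distance-regular with intersection array {b₀,…,b_{d-1}; c₁,…,c_d}
  -- (b is b₀ … b_{d-1}, c is c₁ … c_d; diameter ≤ d, i.e. b_d = 0)
  record IsDistanceRegular (d : ℕ) (b c : Vec ℕ d) : Set where
    field
      connected : ∀ x y → ∃[ n ] (n ≤ d × Dist n x y)
      b-count : ∀ (i : Fin d) x y → Dist (toℕ i) x y →
                HasExactly (lookup b i) (λ w → Adj y w × Dist (suc (toℕ i)) x w)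
      c-count : ∀ (i : Fin d) x y → Dist (suc (toℕ i)) x y →
                HasExactly (lookup c i) (λ w → Adj y w × Dist (toℕ i) x w)

-- Every element of G is c^z·g₁^x₁g₂^x₂g₃^x₃g₄^x₄ with c = [g₁,g₂] central of
-- order 2.  Take S = {g₁, g₂, g₃, g₄, g₁g₂g₃g₄}.  In Cay(G,S) the distance
-- from e is 0 at e, 1 on S, 2 on the ten other elements with z = 0, and
-- multiplication by c turns distance k into 4 − k, so c is the antipode of e.
-- This candidate distance δ(x,y) = radius(x·y⁻¹) is the graph distance as
-- soon as it vanishes only on the diagonal, grows by at most one along an
-- edge and can always be decreased along an edge; after that the
-- intersection numbers are finite counts over the 32 vertices.
module Submission where

open import Defs
open import Data.Bool using (Bool; true; false; if_then_else_)
open import Data.Bool.Properties using () renaming (_≟_ to _≟ᵇ_)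
open import Data.Nat using (ℕ; zero; suc; _∸_; _≤_; _≤?_; s≤s)
open import Data.Nat.Properties using (≤-reflexive; ≤-trans; ≤-antisym; suc-injective; 0≢1+n) renaming (_≟_ to _≟ℕ_)
open import Data.Fin using (Fin; toℕ; #_)
open import Data.Fin.Properties using (all?) renaming (_≟_ to _≟F_)
open import Data.Vec using (Vec; []; _∷_; lookup)
open import Data.List using (List; []; _∷_; [_]; _++_; length; filter)
open import Data.List.Effectful using (monad)
open import Data.List.Membership.Propositional using (_∈_)
open import Data.List.Membership.Propositional.Properties using (∈-filter⁺; ∈-filter⁻)
open import Data.List.Relation.Unary.Any as Any using (Any)
open import Data.List.Relation.Unary.AllPairs using (allPairs?)
open import Data.List.Relation.Unary.Unique.Propositional using (Unique)
open import Data.List.Relation.Unary.Unique.Propositional.Properties using (filter⁺)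
open import Data.Product using (Σ; ∃-syntax; _×_; _,_; proj₂; map₂)
open import Data.Sum using (_⊎_; inj₁; inj₂)
open import Effect.Monad using (RawMonad)
open import Function using (_∘_)
open import Function.Bundles using (_⇔_; mk⇔; Equivalence)
open import Function.Properties.Equivalence using () renaming (trans to ⇔-trans)
open import Level using (0ℓ)
open import Relation.Binary.Definitions using (DecidableEquality)
open import Relation.Binary.PropositionalEquality using (_≡_; _≢_; refl; sym; trans; subst)
open import Relation.Nullary using (Dec; ¬?; contradiction)
open import Relation.Nullary.Decidable using (map′; toWitness; _×-dec_; _⊎-dec_; _→-dec_)
open import Relation.Unary using (Decidable)

module _ {V : Set} (Adj : V → V → Set) where

  HasExactly-resp-⇔ : ∀ {k} {P Q : V → Set} → (∀ z → P z ⇔ Q z) →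
                      HasExactly Adj k P → HasExactly Adj k Q
  HasExactly-resp-⇔ P⇔Q (l , len , unique , ∈⇔P) =
    l , len , unique , λ z → ⇔-trans (∈⇔P z) (P⇔Q z)

  module Enumeration (elements : List V) (∈-elements : ∀ x → x ∈ elements)
                     (elements-unique : Unique elements) where

    hasExactly-filter : ∀ {k} {P : V → Set} (P? : Decidable P) →
                        length (filter P? elements) ≡ k → HasExactly Adj k P
    hasExactly-filter P? counted =
      filter P? elements , counted , filter⁺ P? elements-unique ,
      λ z → mk⇔ (proj₂ ∘ ∈-filter⁻ P? {xs = elements}) (∈-filter⁺ P? (∈-elements z))

  module GraphDistance
    (δ : V → V → ℕ)
    (δ≡0⇒≡ : ∀ x y → δ x y ≡ 0 → x ≡ y)
    (δ-refl : ∀ x → δ x x ≡ 0)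
    (δ-adj : ∀ x y z → Adj x y → δ x z ≤ suc (δ y z))
    (δ-descent : ∀ x y {n} → δ x y ≡ suc n → ∃[ w ] (Adj x w × δ w y ≡ n))
    where

    walk-of-length-δ : ∀ n {x y} → δ x y ≡ n → Walk Adj n x y
    walk-of-length-δ zero    {x} {y} δ≡0 = subst (Walk Adj 0 x) (δ≡0⇒≡ x y δ≡0) here
    walk-of-length-δ (suc n) {x} {y} δ≡1+n with δ-descent x y δ≡1+n
    ... | w , x~w , δ≡n = step x~w (walk-of-length-δ n δ≡n)

    δ≤length : ∀ {n x y} → Walk Adj n x y → δ x y ≤ n
    δ≤length {x = x} here = ≤-reflexive (δ-refl x)
    δ≤length {x = x} {z} (step {y = y} x~y walk) =
      ≤-trans (δ-adj x y z x~y) (s≤s (δ≤length walk))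

    Dist⇔δ : ∀ {n x y} → Dist Adj n x y ⇔ δ x y ≡ n
    Dist⇔δ = mk⇔
      (λ (walk , minimal) → ≤-antisym (δ≤length walk) (minimal _ (walk-of-length-δ _ refl)))
      (λ δ≡n → walk-of-length-δ _ δ≡n , λ m walk → subst (_≤ m) δ≡n (δ≤length walk))

    isDistanceRegular : ∀ {d} {b c : Vec ℕ d} →
      (∀ x y → δ x y ≤ d) →
      (∀ i x y → δ x y ≡ toℕ i →
        HasExactly Adj (lookup b i) (λ w → Adj y w × δ x w ≡ suc (toℕ i))) →
      (∀ i x y → δ x y ≡ suc (toℕ i) →
        HasExactly Adj (lookup c i) (λ w → Adj y w × δ x w ≡ toℕ i)) →
      IsDistanceRegular Adj d b c
    isDistanceRegular δ≤d b-counts c-counts = record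
      { connected = λ x y → δ x y , δ≤d x y , Equivalence.from Dist⇔δ refl
      ; b-count   = λ i x y dist →
          HasExactly-resp-⇔ (λ w → δ-side) (b-counts i x y (Equivalence.to Dist⇔δ dist))
      ; c-count   = λ i x y dist →
          HasExactly-resp-⇔ (λ w → δ-side) (c-counts i x y (Equivalence.to Dist⇔δ dist))
      }
      where
      δ-side : ∀ {A : Set} {n x w} → (A × δ x w ≡ n) ⇔ (A × Dist Adj n x w)
      δ-side = mk⇔ (map₂ (Equivalence.from Dist⇔δ)) (map₂ (Equivalence.to Dist⇔δ))

∀-Bool? : {P : Bool → Set} → (∀ b → Dec (P b)) → Dec (∀ b → P b)
∀-Bool? P? = map′ (λ { (f , t) false → f ; (f , t) true → t }) (λ h → h false , h true)
                  (P? false ×-dec P? true)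

-- A fact proved as  toWitness {a? = d} _  is checked by evaluating the
-- decision d while type checking.
∀-G? : {P : G → Set} → Decidable P → Dec (∀ g → P g)
∀-G? P? = map′ (λ h (mkG a b c d z) → h a b c d z) (λ h a b c d z → h (mkG a b c d z))
  (∀-Bool? λ a → ∀-Bool? λ b → ∀-Bool? λ c → ∀-Bool? λ d → ∀-Bool? λ z → P? (mkG a b c d z))

infix 4 _≟G_
_≟G_ : DecidableEquality G
mkG a b c d z ≟G mkG a′ b′ c′ d′ z′ =
  map′ (λ { (refl , refl , refl , refl , refl) → refl })
       (λ { refl → refl , refl , refl , refl , refl })
       (a ≟ᵇ a′ ×-dec b ≟ᵇ b′ ×-dec c ≟ᵇ c′ ×-dec d ≟ᵇ d′ ×-dec z ≟ᵇ z′)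

elements : List G
elements = do
  a ← bools ; b ← bools ; c ← bools ; d ← bools ; z ← bools
  [ mkG a b c d z ]
  where
  open RawMonad {f = 0ℓ} monad
  bools : List Bool
  bools = false ∷ true ∷ []

∈-elements : ∀ g → g ∈ elements
∈-elements = toWitness {a? = ∀-G? λ g → Any.any? (g ≟G_) elements} _

elements-unique : Unique elements
elements-unique = toWitness {a? = allPairs? (λ g h → ¬? (g ≟G h)) elements} _

c : G
c = mkG false false false false true

generators-involutions : (i : Fin 4) → gen i ≢ e × gen i · gen i ≡ e
generators-involutions = toWitness {a? = all? λ i → ¬? (gen i ≟G e) ×-dec gen i · gen i ≟G e} _

commutators-equal-c : (i j : Fin 4) → i ≢ j → comm (gen i) (gen j) ≡ c
commutators-equal-c = toWitness
  {a? = all? λ i → all? λ j → ¬? (i ≟F j) →-dec comm (gen i) (gen j) ≟G c} _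

normal-form : G → List (Fin 4)
normal-form (mkG x₁ x₂ x₃ x₄ z) =
  power z (# 0 ∷ # 1 ∷ # 0 ∷ # 1 ∷ []) ++ power x₁ [ # 0 ] ++ power x₂ [ # 1 ] ++
  power x₃ [ # 2 ] ++ power x₄ [ # 3 ]
  where
  power : Bool → List (Fin 4) → List (Fin 4)
  power k w = if k then w else []

generated : (g : G) → Σ (List (Fin 4)) (λ w → word w ≡ g)
generated g = normal-form g , toWitness {a? = ∀-G? λ g → word (normal-form g) ≟G g} _ g

S : G → Bool
S (mkG true  false false false false) = true
S (mkG false true  false false false) = true
S (mkG false false true  false false) = true
S (mkG false false false true  false) = true
S (mkG true  true  true  true  false) = true
S _                                   = false

Adj : G → G → Set
Adj = Cay S

Adj? : ∀ x y → Dec (Adj x y)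
Adj? x y = S (x · inv y) ≟ᵇ true

S-inverse-closed : (g : G) → S (inv g) ≡ S g
S-inverse-closed = toWitness {a? = ∀-G? λ g → S (inv g) ≟ᵇ S g} _

open Enumeration Adj elements ∈-elements elements-unique

layer : G → ℕ
layer (mkG false false false false _) = 0
layer (mkG x₁ x₂ x₃ x₄ _) = if S (mkG x₁ x₂ x₃ x₄ false) then 1 else 2

radius : G → ℕ
radius g = if G.z g then 4 ∸ layer g else layer g

δ : G → G → ℕ
δ x y = radius (x · inv y)

δ≡0⇒≡ : ∀ x y → δ x y ≡ 0 → x ≡ y
δ≡0⇒≡ = toWitness {a? = ∀-G? λ x → ∀-G? λ y → δ x y ≟ℕ 0 →-dec x ≟G y} _

δ-refl : ∀ x → δ x x ≡ 0
δ-refl = toWitness {a? = ∀-G? λ x → δ x x ≟ℕ 0} _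

δ-adj : ∀ x y z → Adj x y → δ x z ≤ suc (δ y z)
δ-adj = toWitness
  {a? = ∀-G? λ x → ∀-G? λ y → ∀-G? λ z → Adj? x y →-dec δ x z ≤? suc (δ y z)} _

descends-or-zero : ∀ x y → δ x y ≡ 0 ⊎ Any (λ w → Adj x w × suc (δ w y) ≡ δ x y) elements
descends-or-zero = toWitness {a? = ∀-G? λ x → ∀-G? λ y →
  δ x y ≟ℕ 0 ⊎-dec Any.any? (λ w → Adj? x w ×-dec suc (δ w y) ≟ℕ δ x y) elements} _

δ-descent : ∀ x y {n} → δ x y ≡ suc n → ∃[ w ] (Adj x w × δ w y ≡ n)
δ-descent x y {n} δ≡1+n = descend (descends-or-zero x y)
  where
  descend : δ x y ≡ 0 ⊎ Any (λ w → Adj x w × suc (δ w y) ≡ δ x y) elements →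
            ∃[ w ] (Adj x w × δ w y ≡ n)
  descend (inj₁ δ≡0)      = contradiction (trans (sym δ≡0) δ≡1+n) 0≢1+n
  descend (inj₂ descends) =
    let w , x~w , 1+δ≡δ = Any.satisfied descends in w , x~w , suc-injective (trans 1+δ≡δ δ≡1+n)

open GraphDistance Adj δ δ≡0⇒≡ δ-refl δ-adj δ-descent

b-array c-array : Vec ℕ 4
b-array = 5 ∷ 4 ∷ 1 ∷ 1 ∷ []
c-array = 1 ∷ 1 ∷ 4 ∷ 5 ∷ []

δ≤4 : ∀ x y → δ x y ≤ 4
δ≤4 = toWitness {a? = ∀-G? λ x → ∀-G? λ y → δ x y ≤? 4} _

neighbour-at? : ∀ x y k w → Dec (Adj y w × δ x w ≡ k)
neighbour-at? x y k w = Adj? y w ×-dec δ x w ≟ℕ k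

b-counts : ∀ i x y → δ x y ≡ toℕ i →
           HasExactly Adj (lookup b-array i) (λ w → Adj y w × δ x w ≡ suc (toℕ i))
b-counts i x y δ≡i = hasExactly-filter (neighbour-at? x y (suc (toℕ i))) (counted x y i δ≡i)
  where
  counted : ∀ x y i → δ x y ≡ toℕ i →
            length (filter (neighbour-at? x y (suc (toℕ i))) elements) ≡ lookup b-array i
  counted = toWitness {a? = ∀-G? λ x → ∀-G? λ y → all? λ i → δ x y ≟ℕ toℕ i →-dec
    length (filter (neighbour-at? x y (suc (toℕ i))) elements) ≟ℕ lookup b-array i} _

c-counts : ∀ i x y → δ x y ≡ suc (toℕ i) →
           HasExactly Adj (lookup c-array i) (λ w → Adj y w × δ x w ≡ toℕ i)
c-counts i x y δ≡1+i = hasExactly-filter (neighbour-at? x y (toℕ i)) (counted x y i δ≡1+i)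
  where
  counted : ∀ x y i → δ x y ≡ suc (toℕ i) →
            length (filter (neighbour-at? x y (toℕ i)) elements) ≡ lookup c-array i
  counted = toWitness {a? = ∀-G? λ x → ∀-G? λ y → all? λ i → δ x y ≟ℕ suc (toℕ i) →-dec
    length (filter (neighbour-at? x y (toℕ i)) elements) ≟ℕ lookup c-array i} _

proposition6p1 :
    -- G is as described: g₁…g₄ have order 2, all [gᵢ,gⱼ] (i ≠ j) equal one
    -- and the same element, and g₁…g₄ generate G
    ((i : Fin 4) → gen i ≢ e × gen i · gen i ≡ e)
    × Σ G (λ c → (i j : Fin 4) → i ≢ j → comm (gen i) (gen j) ≡ c)
    × ((x : G) → Σ (List (Fin 4)) (λ w → word w ≡ x))
    -- the Armanios-Wells graph is a Cayley graph over G
    × Σ (G → Bool) (λ S →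
        S e ≡ false
        × ((g : G) → S (inv g) ≡ S g)
        × IsDistanceRegular (Cay S) 4 (5 ∷ 4 ∷ 1 ∷ 1 ∷ []) (1 ∷ 1 ∷ 4 ∷ 5 ∷ []))
proposition6p1 =
  generators-involutions , (c , commutators-equal-c) , generated ,
  S , refl , S-inverse-closed , isDistanceRegular δ≤4 b-counts c-counts
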